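{- Let $s$ be a string with Lyndon runs $F_1,\dots,F_m$. Let $d\ge1$, $1\le i\le m-d$, and suppose $\mathrm{dom}_{d+1}(F_i)$, $\mathrm{dom}_d(F_{i+1})$ is a tandem domain. Then the substring of $s$ associated with this tandem domain contains an LZ77 phrase boundary.
   Context: Let $s=f_1^{e_1}\cdots f_m^{e_m}$ be the Lyndon factorization of $s$ (each $f_i$ a Lyndon word, i.e. a nonempty string strictly lexicographically smaller than all its nonempty proper suffixes; $e_i\ge1$; $f_i\succ f_{i+1}$) and $F_i=f_i^{e_i}$ the Lyndon runs, viewed as consecutive substrings of $s$. For $d\ge1$, $1\le i\le m-d+1$, the leftmost occurrence of $F_i\cdots F_{i+d-1}$ in $s$ begins at the first position of some run $F_j$, $j\le i$; the $d$-domain is $\mathrm{dom}_d(F_i)=F_j\cdots F_{i-1}$ (empty if $j=i$) and the extended $d$-domain is $\mathrm{extdom}_d(F_i)=F_j\cdots F_{i+d-1}$, both as substrings (positions) of $s$. For $d\ge1$, $1\le i\le m-d$, the pair $\mathrm{dom}_{d+1}(F_i)$, $\mathrm{dom}_d(F_{i+1})$ is a tandem domain if $\mathrm{extdom}_{d+1}(F_i)=\mathrm{extdom}_d(F_{i+1})$ (equivalently $\mathrm{dom}_{d+1}(F_i)F_i=\mathrm{dom}_d(F_{i+1})$; $\mathrm{dom}_{d+1}(F_i)$ may be empty). In that case $F_{i+1}\cdots F_{i+d}$ is a prefix of $F_i$; write $F_i=F_{i+1}\cdots F_{i+d}x$. The leftmost occurrence of $F_i\cdots F_{i+d}$ in $s$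 then reads $F_{i+1}\cdots F_{i+d}\,x\,F_{i+1}\cdots F_{i+d}$, and the occurrence of $xF_{i+1}\cdots F_{i+d}$ forming its suffix is the substring associated with the tandem domain. The non-overlapping LZ factorization $s=p_1\cdots p_z$ is built greedily left to right: each phrase $p_t$ is either the leftmost occurrence of a letter, or the longest prefix of $p_t\cdots p_z$ occurring as a substring of $p_1\cdots p_{t-1}$. A substring $s[a..b]$ contains an LZ77 phrase boundary if some phrase begins at one of positions $a,\dots,b$. -}

module Defs where

open import Data.Nat using (ℕ; zero; suc; _+_; _∸_; _≤_; _<_)
open import Data.List using (List; []; _∷_; _++_; length; take; drop; concat; replicate)
open import Data.Product using (Σ; _×_; _,_; ∃)
open import Data.Sum using (_⊎_)
open import Relation.Binary.PropositionalEquality using (_≡_)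
open import Relation.Nullary using (¬_)

-- Strings are lists over an alphabet A; positions are 0-based.

data Lex {A : Set} (_<ₐ_ : A → A → Set) : List A → List A → Set where
  nil<cons : ∀ {b v} → Lex _<ₐ_ [] (b ∷ v)
  head<    : ∀ {a b u v} → a <ₐ b → Lex _<ₐ_ (a ∷ u) (b ∷ v)
  tail<    : ∀ {a u v} → Lex _<ₐ_ u v → Lex _<ₐ_ (a ∷ u) (a ∷ v)

Lyndon : {A : Set} → (A → A → Set) → List A → Set
Lyndon _<ₐ_ w = (0 < length w) × (∀ k → 0 < k → k < length w → Lex _<ₐ_ w (drop k w))

pow : {A : Set} → ℕ → List A → List A
pow n w = concat (replicate n w)

-- Lyndon runs F_i = f_i^{e_i} (indices 1-based; f, e given as functions on ℕ,
-- only the values at 1..m matter).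
Run : {A : Set} → (ℕ → List A) → (ℕ → ℕ) → ℕ → List A
Run f e i = pow (e i) (f i)

runsPrefix : {A : Set} → (ℕ → List A) → (ℕ → ℕ) → ℕ → List A
runsPrefix f e zero    = []
runsPrefix f e (suc k) = runsPrefix f e k ++ Run f e (suc k)

LyndonFactorization : {A : Set} → (A → A → Set) → List A → ℕ → (ℕ → List A) → (ℕ → ℕ) → Set
LyndonFactorization _<ₐ_ s m f e =
  (∀ i → 1 ≤ i → i ≤ m → Lyndon _<ₐ_ (f i) × 1 ≤ e i) ×
  (∀ i → 1 ≤ i → i < m → Lex _<ₐ_ (f (suc i)) (f i)) ×
  (s ≡ runsPrefix f e m)

-- 0-based starting position in s of run F_j (j ≥ 1); start (m+1) = |s|.
runStart : {A : Set} → (ℕ → List A) → (ℕ → ℕ) → ℕ → ℕ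
runStart f e j = length (runsPrefix f e (j ∸ 1))

slice : {A : Set} → List A → ℕ → ℕ → List A
slice s p ℓ = take ℓ (drop p s)

-- the substring F_i ⋯ F_{i+d-1} of s
block : {A : Set} → List A → (ℕ → List A) → (ℕ → ℕ) → ℕ → ℕ → List A
block s f e i d = slice s (runStart f e i) (runStart f e (i + d) ∸ runStart f e i)

OccursAt : {A : Set} → List A → List A → ℕ → Set
OccursAt s w p = slice s p (length w) ≡ w

LeftmostOcc : {A : Set} → List A → List A → ℕ → Set
LeftmostOcc s w p = OccursAt s w p × (∀ q → OccursAt s w q → p ≤ q)

IsSubstring : {A : Set} → List A → List A → Set
IsSubstring u w = ∃ λ q → OccursAt u w q

-- Non-overlapping LZ factorization.
-- PhraseLen s p ℓ : the phrase beginning at position p has length ℓ.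
data PhraseLen {A : Set} (s : List A) (p : ℕ) : ℕ → Set where
  fresh : p < length s → ¬ IsSubstring (take p s) (slice s p 1) → PhraseLen s p 1
  copy  : ∀ {ℓ} → 1 ≤ ℓ → p + ℓ ≤ length s →
          IsSubstring (take p s) (slice s p ℓ) →
          (∀ ℓ′ → ℓ < ℓ′ → p + ℓ′ ≤ length s → ¬ IsSubstring (take p s) (slice s p ℓ′)) →
          PhraseLen s p ℓ

data PhraseStart {A : Set} (s : List A) : ℕ → Set where
  first : 0 < length s → PhraseStart s 0
  next  : ∀ {p ℓ} → PhraseStart s p → PhraseLen s p ℓ → p + ℓ < length s → PhraseStart s (p + ℓ)

ContainsPhraseBoundary : {A : Set} → List A → ℕ → ℕ → Set
ContainsPhraseBoundary s lo hi = ∃ λ q → lo ≤ q × q < hi × PhraseStart s q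

-- dom_{d+1}(F_i), dom_d(F_{i+1}) is a tandem domain, with L the common start
-- of extdom_{d+1}(F_i) = extdom_d(F_{i+1}) (both end at the end of F_{i+d}).
TandemDomainAt : {A : Set} → List A → (ℕ → List A) → (ℕ → ℕ) → ℕ → ℕ → ℕ → Set
TandemDomainAt s f e i d L =
  LeftmostOcc s (block s f e i (suc d)) L × LeftmostOcc s (block s f e (suc i) d) L

-- Start/end (half-open) of the substring associated with the tandem domain:
-- the suffix x F_{i+1}⋯F_{i+d} (length |F_i|) of the leftmost occurrence
-- F_{i+1}⋯F_{i+d} x F_{i+1}⋯F_{i+d} of F_i ⋯ F_{i+d}, which starts at L.
assocStart : {A : Set} → List A → (ℕ → List A) → (ℕ → ℕ) → ℕ → ℕ → ℕ → ℕ
assocStart s f e i d L = L + length (block s f e (suc i) d)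

assocEnd : {A : Set} → List A → (ℕ → List A) → (ℕ → ℕ) → ℕ → ℕ → ℕ → ℕ
assocEnd s f e i d L = assocStart s f e i d L + length (Run f e i)

-- Write w = F_{i+1} ⋯ F_{i+d} and r = |F_i|. Every word in w is a power of some f_j ≤ f_{i+1} < f_i,
-- so the Lyndon word f_i, a prefix of F_i, cannot be a prefix of w; as w and F_i w both occur at the
-- leftmost position L of w, this forces |w| ≤ r, and w occurs again at L + r. Let the LZ phrase
-- covering position L + |w| start at p. If p < L + |w| and the phrase reached the end L + r + |w| of
-- the second occurrence, it would contain that occurrence (as p ≤ L + r), and its earlier source
-- would yield an occurrence of w ending before p < L + |w|, i.e. starting before L. Hence either p or
-- the end of this phrase is a boundary inside [L + |w|, L + |w| + r).
module Submission where

open import Defs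
open import Data.Empty using (⊥-elim)
open import Data.List using (List; []; _∷_; _++_; length; take; drop; concat; replicate)
open import Data.List.Membership.Propositional using (_∈_)
open import Data.List.Properties
  using (length-++; length-take; length-drop; take-take; take-drop; drop-drop; drop-all; take-all;
         take++drop≡id; concat-++; ++-assoc; ++-identityʳ; ≡-dec)
open import Data.List.Relation.Binary.Prefix.Heterogeneous using (Prefix; []; _∷_)
import Data.List.Relation.Binary.Prefix.Heterogeneous.Properties as Prefix
open import Data.List.Relation.Unary.All as All using (All)
open import Data.List.Relation.Unary.All.Properties using (++⁺; replicate⁺)
open import Data.List.Relation.Unary.Any using (here; there)
open import Data.Nat using (ℕ; zero; suc; _+_; _∸_; _⊓_; _≤_; _<_; z≤n; s≤s; s≤s⁻¹; _<?_)
open import Data.Nat.Properties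
open import Algebra.Properties.CommutativeSemigroup +-commutativeSemigroup using (x∙yz≈xz∙y; xy∙z≈xz∙y)
open import Data.Product using (∃; ∃₂; _×_; _,_; proj₁; proj₂)
open import Data.Sum using (_⊎_; inj₁; inj₂)
import Data.Sum as Sum
open import Relation.Binary.Definitions using (DecidableEquality)
open import Relation.Binary.PropositionalEquality using (_≡_; refl; sym; trans; cong; cong₂; subst; module ≡-Reasoning)
open import Relation.Binary.Structures using (IsStrictPartialOrder; IsStrictTotalOrder)
open import Relation.Nullary using (¬_; Dec; yes; no)
open import Relation.Unary using (Decidable)

greatest : {P : ℕ → Set} → Decidable P → P 0 → ∀ N →
           ∃ λ l → l ≤ N × P l × (∀ {l′} → l < l′ → l′ ≤ N → ¬ P l′)
greatest P? P0 zero = 0 , z≤n , P0 , λ l<l′ l′≤l → ⊥-elim (<⇒≱ l<l′ l′≤l)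
greatest {P} P? P0 (suc N) with P? (suc N)
... | yes PN = suc N , ≤-refl , PN , λ l<l′ l′≤l → ⊥-elim (<⇒≱ l<l′ l′≤l)
... | no ¬PN with greatest P? P0 N
...   | l , l≤N , Pl , longest = l , m≤n⇒m≤1+n l≤N , Pl , still-longest
  where
  still-longest : ∀ {l′} → l < l′ → l′ ≤ suc N → ¬ P l′
  still-longest l<l′ l′≤1+N with m≤n⇒m<n∨m≡n l′≤1+N
  ... | inj₁ l′<1+N = longest l<l′ (s≤s⁻¹ l′<1+N)
  ... | inj₂ refl   = ¬PN

module _ {A : Set} where

  infix 4 _⊑_
  _⊑_ : List A → List A → Set
  _⊑_ = Prefix _≡_

  ⊑-++ʳ : ∀ (u t : List A) → u ⊑ u ++ t
  ⊑-++ʳ []      t = []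
  ⊑-++ʳ (a ∷ u) t = refl ∷ ⊑-++ʳ u t

  pow-⊑ : ∀ {w : List A} n → 1 ≤ n → w ⊑ pow n w
  pow-⊑ {w} (suc n) _ = ⊑-++ʳ w (pow n w)

  take-⊑ : ∀ n (xs : List A) → take n xs ⊑ xs
  take-⊑ n xs = subst (take n xs ⊑_) (take++drop≡id n xs) (⊑-++ʳ (take n xs) (drop n xs))

  ⊑-++-split : ∀ {w u r : List A} → w ⊑ u ++ r →
               w ⊑ u ⊎ ∃ λ y → 0 < length y × w ≡ u ++ y × y ⊑ r
  ⊑-++-split {[]}              _          = inj₁ []
  ⊑-++-split {a ∷ w} {[]}      w⊑r        = inj₂ (a ∷ w , s≤s z≤n , refl , w⊑r)
  ⊑-++-split {a ∷ w} {_ ∷ u}   (refl ∷ p) =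
    Sum.map (refl ∷_) (λ (y , 0<y , w≡ , y⊑r) → y , 0<y , cong (a ∷_) w≡ , y⊑r) (⊑-++-split p)

  ⊑-concat-split : ∀ {w : List A} hs → 0 < length w → w ⊑ concat hs →
                   ∃₂ λ t v → ∃ λ h → h ∈ hs × 0 < length v × v ⊑ h × w ≡ t ++ v
  ⊑-concat-split {_ ∷ _} [] _ ()
  ⊑-concat-split (h ∷ hs) 0<w w⊑ with ⊑-++-split {r = concat hs} w⊑
  ... | inj₁ w⊑h = [] , _ , h , here refl , 0<w , w⊑h , refl
  ... | inj₂ (y , 0<y , w≡h++y , y⊑) =
    let t , v , h′ , h′∈ , 0<v , v⊑h′ , y≡t++v = ⊑-concat-split hs 0<y y⊑
    in h ++ t , v , h′ , there h′∈ , 0<v , v⊑h′ ,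
       trans w≡h++y (trans (cong (h ++_) y≡t++v) (sym (++-assoc h t v)))

  drop-length-++ : ∀ (u v : List A) → drop (length u) (u ++ v) ≡ v
  drop-length-++ []      v = refl
  drop-length-++ (_ ∷ u) v = drop-length-++ u v

  take-length-++ : ∀ (u v : List A) → take (length u) (u ++ v) ≡ u
  take-length-++ []      v = refl
  take-length-++ (a ∷ u) v = cong (a ∷_) (take-length-++ u v)

  drop-⊓-length : ∀ n (xs : List A) → drop (n ⊓ length xs) xs ≡ drop n xs
  drop-⊓-length n xs with ≤-total n (length xs)
  ... | inj₁ n≤ = cong (λ k → drop k xs) (m≤n⇒m⊓n≡m n≤)
  ... | inj₂ ≤n = begin
    drop (n ⊓ length xs) xs   ≡⟨ cong (λ k → drop k xs) (m≥n⇒m⊓n≡n ≤n) ⟩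
    drop (length xs) xs       ≡⟨ drop-all (length xs) xs ≤-refl ⟩
    []                        ≡⟨ drop-all n xs ≤n ⟨
    drop n xs                 ∎
    where open ≡-Reasoning

  take-drop-take : ∀ o k l (xs : List A) → o + k ≤ l →
                   take k (drop o (take l xs)) ≡ take k (drop o xs)
  take-drop-take o k l xs o+k≤l = begin
    take k (drop o (take l xs))        ≡⟨ take-drop k o (take l xs) ⟩
    drop o (take (o + k) (take l xs))  ≡⟨ cong (drop o) (take-take (o + k) l xs) ⟩
    drop o (take ((o + k) ⊓ l) xs)     ≡⟨ cong (λ n → drop o (take n xs)) (m≤n⇒m⊓n≡m o+k≤l) ⟩
    drop o (take (o + k) xs)           ≡⟨ take-drop k o xs ⟨
    take k (drop o xs)                 ∎
    where open ≡-Reasoning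

  slice-slice : ∀ (s : List A) p o k l → o + k ≤ l →
                take k (drop o (slice s p l)) ≡ slice s (p + o) k
  slice-slice s p o k l o+k≤l =
    trans (take-drop-take o k l (drop p s) o+k≤l) (cong (take k) (drop-drop p o s))

  slice-take : ∀ (s : List A) p q l → q + l ≤ p → slice (take p s) q l ≡ slice s q l
  slice-take s p q l = take-drop-take q l p s

  length-slice : ∀ (s : List A) p l → length (slice s p l) ≡ l ⊓ (length s ∸ p)
  length-slice s p l = trans (length-take l (drop p s)) (cong (l ⊓_) (length-drop p s))

  slice-length : ∀ (s : List A) p l → p + l ≤ length s → length (slice s p l) ≡ l
  slice-length s p l p+l≤ =
    trans (length-slice s p l) (m≤n⇒m⊓n≡m (m+n≤o⇒m≤o∸n l (subst (_≤ length s) (+-comm p l) p+l≤)))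

  slice-length⁻¹ : ∀ (s : List A) p l → 0 < l → length (slice s p l) ≡ l → p + l ≤ length s
  slice-length⁻¹ s p l 0<l len≡l = subst (_≤ length s) (+-comm l p) (m≤o∸n⇒m+n≤o l p≤s l≤s∸p)
    where
    l≤s∸p : l ≤ length s ∸ p
    l≤s∸p = m⊓n≡m⇒m≤n (trans (sym (length-slice s p l)) len≡l)
    p≤s : p ≤ length s
    p≤s = <⇒≤ (m∸n≢0⇒n<m λ s∸p≡0 → <⇒≱ 0<l (subst (l ≤_) s∸p≡0 l≤s∸p))

  occurs-within : ∀ {s w : List A} {p} → OccursAt s w p → 0 < length w → p + length w ≤ length s
  occurs-within {s} {w} {p} occ 0<w = slice-length⁻¹ s p (length w) 0<w (cong length occ)

  occurs-++ʳ : ∀ {s u v : List A} {p} → OccursAt s (u ++ v) p → OccursAt s v (p + length u)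
  occurs-++ʳ {s} {u} {v} {p} occ = begin
    slice s (p + length u) (length v)
      ≡⟨ slice-slice s p (length u) (length v) (length (u ++ v)) (≤-reflexive (sym (length-++ u))) ⟨
    take (length v) (drop (length u) (slice s p (length (u ++ v))))
      ≡⟨ cong (λ x → take (length v) (drop (length u) x)) occ ⟩
    take (length v) (drop (length u) (u ++ v))
      ≡⟨ cong (take (length v)) (drop-length-++ u v) ⟩
    take (length v) v
      ≡⟨ take-all (length v) v ≤-refl ⟩
    v ∎
    where open ≡-Reasoning

  occurs-clamp : ∀ {u w : List A} {q} → OccursAt u w q → OccursAt u w (q ⊓ length u)
  occurs-clamp {u} {w} {q} occ = trans (cong (take (length w)) (drop-⊓-length q u)) occ

  occurs-same-start-⊑ : ∀ {s x y : List A} {p} → OccursAt s x p → OccursAt s y p →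
                        length x ≤ length y → x ⊑ y
  occurs-same-start-⊑ {s} {x} {y} {p} occx occy |x|≤|y| = subst (_⊑ y) (sym x≡) (take-⊑ (length x) y)
    where
    x≡ : x ≡ take (length x) y
    x≡ = begin
      x                                       ≡⟨ occx ⟨
      take (length x) (drop p s)              ≡⟨ cong (λ n → take n (drop p s)) (m≤n⇒m⊓n≡m |x|≤|y|) ⟨
      take (length x ⊓ length y) (drop p s)   ≡⟨ take-take (length x) (length y) (drop p s) ⟨
      take (length x) (slice s p (length y))  ≡⟨ cong (take (length x)) occy ⟩
      take (length x) y                       ∎
      where open ≡-Reasoning

  occurs-same-start-≤ : ∀ {s u x : List A} {p} → OccursAt s x p → OccursAt s (u ++ x) p →
                        ¬ u ⊑ x → length x ≤ length u
  occurs-same-start-≤ {u = u} {x} {p} occx occux u⋢x with ⊑-++-split {u = u} x⊑u++x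
    where
    x⊑u++x : x ⊑ u ++ x
    x⊑u++x = occurs-same-start-⊑ {p = p} occx occux
               (≤-trans (m≤n+m (length x) (length u)) (≤-reflexive (sym (length-++ u))))
  ... | inj₁ x⊑u = Prefix.length-mono x⊑u
  ... | inj₂ (y , _ , x≡u++y , _) = ⊥-elim (u⋢x (subst (u ⊑_) (sym x≡u++y) (⊑-++ʳ u y)))

  occurs-copy : ∀ {s w : List A} {p q o l} → slice s q l ≡ slice s p l →
                OccursAt s w (p + o) → o + length w ≤ l → OccursAt s w (q + o)
  occurs-copy {s} {w} {p} {q} {o} {l} same occ o+w≤l = begin
    slice s (q + o) (length w)                    ≡⟨ slice-slice s q o (length w) l o+w≤l ⟨
    take (length w) (drop o (slice s q l))        ≡⟨ cong (λ x → take (length w) (drop o x)) same ⟩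
    take (length w) (drop o (slice s p l))        ≡⟨ slice-slice s p o (length w) l o+w≤l ⟩
    slice s (p + o) (length w)                    ≡⟨ occ ⟩
    w                                             ∎
    where open ≡-Reasoning

  phraseLen-positive : ∀ {s : List A} {p l} → PhraseLen s p l → 1 ≤ l
  phraseLen-positive (fresh _ _)      = ≤-refl
  phraseLen-positive (copy 1≤l _ _ _) = 1≤l

  phrase-source : ∀ {s : List A} {p l} → PhraseLen s p l → 2 ≤ l →
                  ∃ λ q → q + l ≤ p × slice s q l ≡ slice s p l
  phrase-source (fresh _ _) (s≤s ())
  phrase-source {s} {p} {l} (copy 1≤l p+l≤ (q , occ) _) _ =
    q , q+l≤p , trans (sym (slice-take s p q l q+l≤p)) occ′
    where
    occ′ : slice (take p s) q l ≡ slice s p l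
    occ′ = subst (λ n → slice (take p s) q n ≡ slice s p l) (slice-length s p l p+l≤) occ
    q+l≤p : q + l ≤ p
    q+l≤p = ≤-trans (slice-length⁻¹ (take p s) q l 1≤l (trans (cong length occ′) (slice-length s p l p+l≤)))
                    (≤-trans (≤-reflexive (length-take p s)) (m⊓n≤m p (length s)))

  occurs-in-copy : ∀ {s w : List A} {p l c} → PhraseLen s p l → 2 ≤ l →
                   OccursAt s w c → p ≤ c → c + length w ≤ p + l →
                   ∃ λ q → q + length w ≤ p × OccursAt s w q
  occurs-in-copy {w = w} {p} {l} phrase 2≤l occ p≤c end≤
    with phrase-source phrase 2≤l | m≤n⇒∃[o]m+o≡n p≤c
  ... | q , q+l≤p , same | o , refl = q + o , q+o+w≤p , occurs-copy {p = p} {q} same occ o+w≤l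
    where
    o+w≤l : o + length w ≤ l
    o+w≤l = +-cancelˡ-≤ p (o + length w) l (≤-trans (≤-reflexive (sym (+-assoc p o (length w)))) end≤)
    q+o+w≤p : q + o + length w ≤ p
    q+o+w≤p = ≤-trans (≤-reflexive (+-assoc q o (length w))) (≤-trans (+-monoʳ-≤ q o+w≤l) q+l≤p)

  phrase-ends-before-copy : ∀ {s w : List A} {L k p l} → (∀ q → OccursAt s w q → L ≤ q) →
    OccursAt s w (L + k) → length w ≤ k → 0 < k → PhraseLen s p l → p < L + length w →
    ¬ (L + length w + k ≤ p + l)
  phrase-ends-before-copy {w = w} {L} {k} {p} {l} leftmost occ w≤k 0<k phrase p<a E≤p+l =
    let q , q+w≤p , occ-q = occurs-in-copy phrase 2≤l occ p≤L+k
                              (≤-trans (≤-reflexive (xy∙z≈xz∙y L k (length w))) E≤p+l)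
    in <⇒≱ p<a (≤-trans (+-monoˡ-≤ (length w) (leftmost q occ-q)) q+w≤p)
    where
    2≤l : 2 ≤ l
    2≤l = +-cancelˡ-≤ p 2 l (subst (_≤ p + l) (+-comm 2 p)
            (≤-trans (≤-trans (s≤s p<a) (m<m+n (L + length w) 0<k)) E≤p+l))
    p≤L+k : p ≤ L + k
    p≤L+k = ≤-trans (<⇒≤ p<a) (+-monoʳ-≤ L w≤k)

  module _ (_≟_ : DecidableEquality A) where

    substring? : (u w : List A) → Dec (IsSubstring u w)
    substring? u w with anyUpTo? (λ q → ≡-dec _≟_ (slice u q (length w)) w) (suc (length u))
    ... | yes (q , _ , occ) = yes (q , occ)
    ... | no none =
      no λ (q , occ) → none (q ⊓ length u , s≤s (m⊓n≤n q (length u)) , occurs-clamp {u} {w} {q} occ)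

    -- The empty word is a substring of every prefix, so the longest copyable length always exists.
    phraseLen-exists : ∀ (s : List A) p → p < length s → ∃ (PhraseLen s p)
    phraseLen-exists s p p<s
      with greatest (λ l → substring? (take p s) (slice s p l)) (0 , refl) (length s ∸ p)
    ... | zero  , _ , _ , longest = 1 , fresh p<s (longest (s≤s z≤n) (m<n⇒0<n∸m p<s))
    ... | suc l , l≤ , copyable , longest =
      suc l , copy (s≤s z≤n) (fits l≤) copyable (λ l′ l<l′ p+l′≤ → longest l<l′ (unfits p+l′≤))
      where
      fits : ∀ {k} → k ≤ length s ∸ p → p + k ≤ length s
      fits {k} k≤ = subst (_≤ length s) (+-comm k p) (m≤o∸n⇒m+n≤o k (<⇒≤ p<s) k≤)
      unfits : ∀ {k} → p + k ≤ length s → k ≤ length s ∸ p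
      unfits {k} p+k≤ = m+n≤o⇒m≤o∸n k (subst (_≤ length s) (+-comm p k) p+k≤)

    covering-phrase : ∀ (s : List A) x → x < length s →
                      ∃₂ λ p l → PhraseStart s p × PhraseLen s p l × p ≤ x × x < p + l
    covering-phrase s x x<s = walk (suc x) 0 (first (≤-<-trans z≤n x<s)) z≤n ≤-refl
      where
      walk : ∀ n p → PhraseStart s p → p ≤ x → x < p + n →
             ∃₂ λ p l → PhraseStart s p × PhraseLen s p l × p ≤ x × x < p + l
      walk zero p _ p≤x x<p+0 = ⊥-elim (<⇒≱ (subst (x <_) (+-identityʳ p) x<p+0) p≤x)
      walk (suc n) p start p≤x x<p+1+n
        with phraseLen-exists s p (≤-<-trans p≤x x<s)
      ... | l , phrase with x <? p + l
      ...   | yes x<p+l = p , l , start , phrase , p≤x , x<p+l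
      ...   | no x≮p+l = walk n (p + l) (next start phrase (≤-<-trans p+l≤x x<s)) p+l≤x x<p+l+n
        where
        p+l≤x : p + l ≤ x
        p+l≤x = ≮⇒≥ x≮p+l
        x<p+l+n : x < p + l + n
        x<p+l+n = <-≤-trans x<p+1+n (≤-trans (+-monoʳ-≤ p (+-monoˡ-≤ n (phraseLen-positive phrase)))
                                               (≤-reflexive (sym (+-assoc p l n))))

    boundary-after-leftmost : ∀ (s w : List A) L k → (∀ q → OccursAt s w q → L ≤ q) →
      OccursAt s w (L + k) → length w ≤ k → 0 < k → L + length w + k ≤ length s →
      ContainsPhraseBoundary s (L + length w) (L + length w + k)
    boundary-after-leftmost s w L k leftmost occ w≤k 0<k E≤s
      with covering-phrase s (L + length w) (<-≤-trans (m<m+n (L + length w) 0<k) E≤s)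
    ... | p , l , start , phrase , p≤a , a<p+l with m≤n⇒m<n∨m≡n p≤a
    ...   | inj₂ refl = p , ≤-refl , m<m+n p 0<k , start
    ...   | inj₁ p<a with p + l <? L + length w + k
    ...     | yes p+l<E = p + l , <⇒≤ a<p+l , p+l<E , next start phrase (<-≤-trans p+l<E E≤s)
    ...     | no p+l≮E =
      ⊥-elim (phrase-ends-before-copy leftmost occ w≤k 0<k phrase p<a (≮⇒≥ p+l≮E))

    boundary-in-tandem : ∀ (s u w : List A) L → LeftmostOcc s w L → OccursAt s (u ++ w) L →
      0 < length u → ¬ u ⊑ w → ContainsPhraseBoundary s (L + length w) (L + length w + length u)
    boundary-in-tandem s u w L (occ-w , leftmost) occ 0<u u⋢w =
      boundary-after-leftmost s w L (length u) leftmost (occurs-++ʳ {s} {u} {w} {L} occ)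
        (occurs-same-start-≤ {p = L} occ-w occ u⋢w) 0<u fits
      where
      fits : L + length w + length u ≤ length s
      fits = subst (_≤ length s)
               (trans (cong (L +_) (length-++ u)) (x∙yz≈xz∙y L (length u) (length w)))
               (occurs-within occ (≤-trans 0<u (Prefix.length-mono (⊑-++ʳ u w))))

module _ {A : Set} (f : ℕ → List A) (e : ℕ → ℕ) where

  runWords : ℕ → ℕ → List (List A)
  runWords j zero    = []
  runWords j (suc k) = replicate (e (suc j)) (f (suc j)) ++ runWords (suc j) k

  concat-runWords-suc : ∀ j k →
                        concat (runWords j (suc k)) ≡ Run f e (suc j) ++ concat (runWords (suc j) k)
  concat-runWords-suc j k = sym (concat-++ (replicate (e (suc j)) (f (suc j))) (runWords (suc j) k))

  runsPrefix-+ : ∀ j k → runsPrefix f e (j + k) ≡ runsPrefix f e j ++ concat (runWords j k)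
  runsPrefix-+ j zero = begin
    runsPrefix f e (j + 0)     ≡⟨ cong (runsPrefix f e) (+-identityʳ j) ⟩
    runsPrefix f e j           ≡⟨ ++-identityʳ (runsPrefix f e j) ⟨
    runsPrefix f e j ++ []     ∎
    where open ≡-Reasoning
  runsPrefix-+ j (suc k) = begin
    runsPrefix f e (j + suc k)
      ≡⟨ cong (runsPrefix f e) (+-suc j k) ⟩
    runsPrefix f e (suc j + k)
      ≡⟨ runsPrefix-+ (suc j) k ⟩
    (runsPrefix f e j ++ Run f e (suc j)) ++ concat (runWords (suc j) k)
      ≡⟨ ++-assoc (runsPrefix f e j) _ _ ⟩
    runsPrefix f e j ++ (Run f e (suc j) ++ concat (runWords (suc j) k))
      ≡⟨ cong (runsPrefix f e j ++_) (concat-runWords-suc j k) ⟨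
    runsPrefix f e j ++ concat (runWords j (suc k)) ∎
    where open ≡-Reasoning

  block-runWords : ∀ {s m} j k → s ≡ runsPrefix f e m → j + k ≤ m →
                   block s f e (suc j) k ≡ concat (runWords j k)
  block-runWords j k s≡ j+k≤m with m≤n⇒∃[o]m+o≡n j+k≤m
  block-runWords j k refl _ | r , refl = begin
    take (length (runsPrefix f e (j + k)) ∸ length P) (drop (length P) (runsPrefix f e (j + k + r)))
      ≡⟨ cong₂ (λ n t → take (n ∸ length P) (drop (length P) t)) (cong length (runsPrefix-+ j k)) whole ⟩
    take (length (P ++ X) ∸ length P) (drop (length P) (P ++ X ++ Y))
      ≡⟨ cong₂ take (trans (cong (_∸ length P) (length-++ P)) (m+n∸m≡n (length P) (length X)))
                    (drop-length-++ P (X ++ Y)) ⟩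
    take (length X) (X ++ Y)
      ≡⟨ take-length-++ X Y ⟩
    X ∎
    where
    open ≡-Reasoning
    P X Y : List A
    P = runsPrefix f e j
    X = concat (runWords j k)
    Y = concat (runWords (j + k) r)
    whole : runsPrefix f e (j + k + r) ≡ P ++ X ++ Y
    whole = trans (runsPrefix-+ (j + k) r) (trans (cong (_++ Y) (runsPrefix-+ j k)) (++-assoc P X Y))

  runWords-all : ∀ (P : List A → Set) j k → (∀ r → j < r → r ≤ j + k → P (f r)) →
                 All P (runWords j k)
  runWords-all P j zero    _  = All.[]
  runWords-all P j (suc k) Pf =
    ++⁺ (replicate⁺ (e (suc j)) (Pf (suc j) ≤-refl (≤-trans (s≤s (m≤m+n j k)) (≤-reflexive j+1+k≡))))
        (runWords-all P (suc j) k λ r j+1<r r≤ →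
           Pf r (<-trans (n<1+n j) j+1<r) (≤-trans r≤ (≤-reflexive j+1+k≡)))
    where
    j+1+k≡ : suc j + k ≡ j + suc k
    j+1+k≡ = sym (+-suc j k)

  block-split : ∀ {s m} i d → s ≡ runsPrefix f e m → suc i + d ≤ m →
                block s f e (suc i) (suc d) ≡ Run f e (suc i) ++ block s f e (suc (suc i)) d
  block-split {s} {m} i d s≡ i+d≤m = begin
    block s f e (suc i) (suc d)
      ≡⟨ block-runWords i (suc d) s≡ (subst (_≤ m) (sym (+-suc i d)) i+d≤m) ⟩
    concat (runWords i (suc d))
      ≡⟨ concat-runWords-suc i d ⟩
    Run f e (suc i) ++ concat (runWords (suc i) d)
      ≡⟨ cong (Run f e (suc i) ++_) (block-runWords (suc i) d s≡ i+d≤m) ⟨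
    Run f e (suc i) ++ block s f e (suc (suc i)) d ∎
    where open ≡-Reasoning

module _ {A : Set} {_<ₐ_ : A → A → Set} where

  ⊑-Lex : ∀ {u h w : List A} → u ⊑ h → Lex _<ₐ_ h w → Lex _<ₐ_ u w
  ⊑-Lex [] nil<cons = nil<cons
  ⊑-Lex [] (head< _) = nil<cons
  ⊑-Lex [] (tail< _) = nil<cons
  ⊑-Lex (refl ∷ _) (head< a<b) = head< a<b
  ⊑-Lex (refl ∷ u⊑h) (tail< h<w) = tail< (⊑-Lex u⊑h h<w)

  module _ (spo : IsStrictPartialOrder _≡_ _<ₐ_) where
    open IsStrictPartialOrder spo using (irrefl) renaming (trans to <ₐ-trans)

    Lex-irrefl : ∀ {w : List A} → ¬ Lex _<ₐ_ w w
    Lex-irrefl (head< a<a) = irrefl refl a<a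
    Lex-irrefl (tail< w<w) = Lex-irrefl w<w

    Lex-trans : ∀ {u v w : List A} → Lex _<ₐ_ u v → Lex _<ₐ_ v w → Lex _<ₐ_ u w
    Lex-trans nil<cons    (head< _)   = nil<cons
    Lex-trans nil<cons    (tail< _)   = nil<cons
    Lex-trans (head< a<b) (head< b<c) = head< (<ₐ-trans a<b b<c)
    Lex-trans (head< a<b) (tail< _)   = head< a<b
    Lex-trans (tail< _)   (head< b<c) = head< b<c
    Lex-trans (tail< u<v) (tail< v<w) = tail< (Lex-trans u<v v<w)

    lyndon-suffix-not-smaller : ∀ {w t v : List A} → Lyndon _<ₐ_ w → w ≡ t ++ v → 0 < length v →
                                ¬ Lex _<ₐ_ v w
    lyndon-suffix-not-smaller {t = []}    _         refl _   v<w = Lex-irrefl v<w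
    lyndon-suffix-not-smaller {w} {t = t@(_ ∷ _)} {v} (_ , smallest) refl 0<v v<w =
      Lex-irrefl (Lex-trans (subst (Lex _<ₐ_ w) (drop-length-++ t v) w<suffix) v<w)
      where
      w<suffix : Lex _<ₐ_ w (drop (length t) w)
      w<suffix = smallest (length t) (s≤s z≤n)
                   (subst (length t <_) (sym (length-++ t)) (m<m+n (length t) 0<v))

    lyndon-not-⊑-concat : ∀ {w : List A} hs → Lyndon _<ₐ_ w → All (λ h → Lex _<ₐ_ h w) hs →
                          ¬ w ⊑ concat hs
    lyndon-not-⊑-concat hs lyndon@(0<w , _) smaller w⊑ =
      let t , v , h , h∈ , 0<v , v⊑h , w≡t++v = ⊑-concat-split hs 0<w w⊑
      in lyndon-suffix-not-smaller lyndon w≡t++v 0<v (⊑-Lex v⊑h (All.lookup smaller h∈))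

    lyndon-periods-decrease : ∀ (f : ℕ → List A) m →
                              (∀ x → 1 ≤ x → x < m → Lex _<ₐ_ (f (suc x)) (f x)) →
                              ∀ {i r} → 1 ≤ i → i < r → r ≤ m → Lex _<ₐ_ (f r) (f i)
    lyndon-periods-decrease f m decreasing {i} {suc r} 1≤i (s≤s i≤r) 1+r≤m with m≤n⇒m<n∨m≡n i≤r
    ... | inj₂ refl = decreasing i 1≤i 1+r≤m
    ... | inj₁ i<r  = Lex-trans (decreasing r (≤-trans 1≤i (<⇒≤ i<r)) 1+r≤m)
                                (lyndon-periods-decrease f m decreasing 1≤i i<r (<⇒≤ 1+r≤m))

    period-⊑-run : ∀ {s m f e i} → LyndonFactorization _<ₐ_ s m f e → 1 ≤ i → i ≤ m → f i ⊑ Run f e i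
    period-⊑-run {e = e} {i} (runs , _) 1≤i i≤m = pow-⊑ (e i) (proj₂ (runs i 1≤i i≤m))

    run-nonempty : ∀ {s m f e i} → LyndonFactorization _<ₐ_ s m f e → 1 ≤ i → i ≤ m →
                   0 < length (Run f e i)
    run-nonempty {i = i} fact@(runs , _) 1≤i i≤m =
      ≤-trans (proj₁ (proj₁ (runs i 1≤i i≤m))) (Prefix.length-mono (period-⊑-run fact 1≤i i≤m))

    run-not-⊑-block : ∀ {s m f e} → LyndonFactorization _<ₐ_ s m f e → ∀ i d → suc i + d ≤ m →
                      ¬ Run f e (suc i) ⊑ block s f e (suc (suc i)) d
    run-not-⊑-block {m = m} {f} {e} fact@(runs , decreasing , s≡) i d i+d≤m F⊑B =
      lyndon-not-⊑-concat (runWords f e (suc i) d) (proj₁ (runs (suc i) (s≤s z≤n) i+1≤m)) smaller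
        (subst (f (suc i) ⊑_) (block-runWords f e (suc i) d s≡ i+d≤m)
               (Prefix.trans trans (period-⊑-run fact (s≤s z≤n) i+1≤m) F⊑B))
      where
      i+1≤m : suc i ≤ m
      i+1≤m = ≤-trans (m≤m+n (suc i) d) i+d≤m
      smaller : All (λ h → Lex _<ₐ_ h (f (suc i))) (runWords f e (suc i) d)
      smaller = runWords-all f e _ (suc i) d λ r i<r r≤ →
                  lyndon-periods-decrease f m decreasing (s≤s z≤n) i<r (≤-trans r≤ i+d≤m)

lemma6 : {A : Set} (_<ₐ_ : A → A → Set) → IsStrictTotalOrder _≡_ _<ₐ_ →
         (s : List A) (m : ℕ) (f : ℕ → List A) (e : ℕ → ℕ) →
         LyndonFactorization _<ₐ_ s m f e →
         (d i : ℕ) → 1 ≤ d → 1 ≤ i → i + d ≤ m →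
         (L : ℕ) → TandemDomainAt s f e i d L →
         ContainsPhraseBoundary s (assocStart s f e i d L) (assocEnd s f e i d L)
lemma6 _ _ _ _ _ _ _ _ zero _ () _ _ _
lemma6 {A} _<ₐ_ sto s m f e factorization d (suc i) _ _ i+d≤m L ((occ-FB , _) , leftmost-B) =
  boundary-in-tandem _≟ₐ_ s F B L leftmost-B occ
    (run-nonempty isStrictPartialOrder factorization (s≤s z≤n) (≤-trans (m≤m+n (suc i) d) i+d≤m))
    (run-not-⊑-block isStrictPartialOrder factorization i d i+d≤m)
  where
  open IsStrictTotalOrder sto using (isStrictPartialOrder) renaming (_≟_ to _≟ₐ_)
  F B : List A
  F = Run f e (suc i)
  B = block s f e (suc (suc i)) d
  occ : OccursAt s (F ++ B) L
  occ = subst (λ x → OccursAt s x L) (block-split f e i d (proj₂ (proj₂ factorization)) i+d≤m) occ-FB
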